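{- Let $G$ be a $K_4$-free finite simple graph with $n$ vertices and $e$ edges, let $P$ be a greedy partition of $G$ with size $r=r(P)$, and let $r_2$ be the number of cliques of $P$ of size at least $2$. Then $e\le r(n-r)+r_2(n-r-r_2)$.
   Context: A good partition $P$ of $V(G)$ is a partition of $V(G)$ into disjoint sets $C_0,C_1,\dots$ (the cliques of $P$), each inducing a complete subgraph of $G$, indexed so that $|C_0|\le |C_1|\le \cdots$. The size $r(P)$ of $P$ is the number of cliques in it. A good partition is a greedy partition if for every $i\ge 1$ the subgraph of $G$ induced by $C_0\cup\dots\cup C_i$ contains no complete subgraph on $|C_i|+1$ vertices. For $K_4$-free $G$, the cliques of a greedy partition have sizes $1$, $2$ or $3$. -}

module Defs where

open import Data.Nat using (ℕ; zero; suc; _≤_; _+_)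
open import Data.Bool using (Bool; true; false; T)
open import Data.Fin using (Fin; toℕ; _<_; _≟_)
import Data.Fin as Fin
open import Data.Fin.Subset using (Subset; _∈_; ∣_∣)
open import Data.Vec using (tabulate)
open import Data.List using (List; length; filter; concatMap; allFin; map)
open import Data.Product using (Σ; _×_; _,_)
open import Relation.Binary.PropositionalEquality using (_≡_; _≢_)
open import Relation.Nullary using (¬_; does)
open import Relation.Nullary.Decidable using (⌊_⌋)

record Graph (n : ℕ) : Set where
  field
    adj   : Fin n → Fin n → Bool
    sym   : ∀ u v → adj u v ≡ adj v u
    irrefl : ∀ v → adj v v ≡ false
open Graph public

edgeCount : ∀ {n} → Graph n → ℕ
edgeCount {n} G =
  length (filter (λ p → Data.Bool._≟_ (adj G (Data.Product.proj₁ p) (Data.Product.proj₂ p)) true)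
           (filter (λ p → Fin._<?_ (Data.Product.proj₁ p) (Data.Product.proj₂ p))
              (concatMap (λ u → map (λ v → (u , v)) (allFin n)) (allFin n))))

IsClique : ∀ {n} → Graph n → Subset n → Set
IsClique G K = ∀ u v → u ∈ K → v ∈ K → u ≢ v → adj G u v ≡ true

HasClique : ∀ {n} → Graph n → ℕ → Set
HasClique {n} G k = Σ (Subset n) λ K → IsClique G K × ∣ K ∣ ≡ k

K4Free : ∀ {n} → Graph n → Set
K4Free G = ¬ HasClique G 4

-- A partition of Fin n into r blocks C_0,…,C_{r-1}, given by the map
-- sending each vertex to the index of its block.
block : ∀ {n r} → (Fin n → Fin r) → Fin r → Subset n
block f i = tabulate (λ v → ⌊ f v ≟ i ⌋)

record GoodPartition {n : ℕ} (G : Graph n) (r : ℕ) : Set where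
  field
    part     : Fin n → Fin r
    nonempty : ∀ i → Σ (Fin n) λ v → part v ≡ i
    clique   : ∀ i → IsClique G (block part i)
    sorted   : ∀ i j → i Fin.≤ j → ∣ block part i ∣ ≤ ∣ block part j ∣
open GoodPartition public

size : ∀ {n r} {G : Graph n} → GoodPartition G r → Fin r → ℕ
size P i = ∣ block (part P) i ∣

IsGreedy : ∀ {n r} {G : Graph n} → GoodPartition G r → Set
IsGreedy {n} {r} {G} P =
  ∀ (i : Fin r) → 1 ≤ toℕ i →
    ¬ (Σ (Subset n) λ K → (∀ v → v ∈ K → part P v Fin.≤ i)
                        × IsClique G K × ∣ K ∣ ≡ suc (size P i))

r₂ : ∀ {n r} {G : Graph n} → GoodPartition G r → ℕ
r₂ {r = r} P = length (filter (λ i → Data.Nat._≤?_ 2 (size P i)) (allFin r))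

-- Build G up block by block: C₀, then C₀ ∪ C₁, and so on.  When the
-- block Cⱼ of size s is added, a vertex u of C₀ ∪ … ∪ Cⱼ has at most s - 1
-- neighbours in Cⱼ: for u ∈ Cⱼ because G has no loops, and for u in an
-- earlier block because otherwise Cⱼ ∪ {u} would be a clique on s + 1
-- vertices inside C₀ ∪ … ∪ Cⱼ, which greediness forbids.  Hence adding Cⱼ
-- creates at most (s - 1) N + s (s - 1) / 2 edges, N the number of earlier
-- vertices.  Since G is K₄-free every s is 1, 2 or 3, so with R (resp. c)
-- the number of blocks of size ≥ 2 (resp. 3) seen so far we have
-- N = t + R + c after t blocks, and an induction on t shows that the edges
-- inside the first t blocks number at most t (R + c) + R c.  For t = r this
-- is the claim, since then n - r = R + c and r₂ = R.

module Submission where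

open import Defs hiding (sym)
open import Data.Nat
  using (ℕ; zero; suc; pred; _+_; _*_; _≤_; _<_; z≤n; s≤s; _≤?_; _<?_)
import Data.Nat.Properties as ℕP
open import Algebra.Properties.CommutativeSemigroup ℕP.*-commutativeSemigroup using (x∙yz≈y∙xz)
open import Data.Nat.Tactic.RingSolver using (solve-∀)
import Data.Integer as ℤ
import Data.Integer.Properties as ℤP
import Data.Integer.Tactic.RingSolver as ℤSolver
open import Data.Bool using (Bool; true; false)
import Data.Bool as Bool
import Data.Bool.Properties as BoolP
open import Data.Fin as Fin using (Fin; zero; suc; toℕ; fromℕ<)
import Data.Fin.Properties as FinP
open import Data.Fin.Subset using (Subset; _∈_; _⊆_; ∣_∣; _∪_; ⁅_⁆)
open import Data.Fin.Subset.Properties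
  using (x∈p∪q⁻; x∈p∪q⁺; p⊆p∪q; x∈⁅x⁆; x∈⁅y⁆⇒x≡y; ∣⁅x⁆∣≡1; p⊆q⇒∣p∣≤∣q∣; p⊂q⇒∣p∣<∣q∣)
open import Data.Vec using ([]; _∷_; tabulate; here; there)
open import Data.Vec.Properties using (lookup∘tabulate; []=⇒lookup; lookup⇒[]=)
import Data.List as List
open import Data.List using (List; []; _∷_; length; filter; concatMap; allFin)
import Data.Nat.ListAction as ListSum
import Data.Nat.ListAction.Properties as ListSumP
import Data.List.Properties as ListP
open import Data.Product using (Σ; _×_; _,_; proj₁; proj₂)
open import Data.Sum as Sum using (_⊎_; inj₁; inj₂)
open import Data.Empty using (⊥; ⊥-elim)
open import Function using (_∘_)
open import Relation.Binary.PropositionalEquality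
open import Relation.Binary.Definitions using (tri<; tri≈; tri>)
open import Relation.Nullary using (Dec; yes; no; does; ¬_; _×-dec_)
open import Relation.Nullary.Decidable using (dec-true; dec-false; isYes)
open import Algebra.Properties.Semiring.Sum ℕP.+-*-semiring
  using (sum; sum-syntax; sum-cong-≗; ∑-distrib-+; ∑-comm; *-distribˡ-sum; sum-replicate-zero)

χ : Bool → ℕ
χ true  = 1
χ false = 0

⟦_⟧ : ∀ {a} {A : Set a} → Dec A → ℕ
⟦ d ⟧ = χ (does d)

⟦⟧-yes : ∀ {a} {A : Set a} (d : Dec A) → A → ⟦ d ⟧ ≡ 1
⟦⟧-yes d a rewrite dec-true d a = refl

⟦⟧-no : ∀ {a} {A : Set a} (d : Dec A) → ¬ A → ⟦ d ⟧ ≡ 0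
⟦⟧-no d ¬a rewrite dec-false d ¬a = refl

⟦⟧≤1 : ∀ {a} {A : Set a} (d : Dec A) → ⟦ d ⟧ ≤ 1
⟦⟧≤1 (yes _) = s≤s z≤n
⟦⟧≤1 (no _)  = z≤n

⟦⟧-witness : ∀ {a} {A : Set a} (d : Dec A) → 0 < ⟦ d ⟧ → A
⟦⟧-witness (yes a) _ = a
⟦⟧-witness (no _) ()

fromℕ<-value : ∀ {r t} (t<r : t < r) {x : Fin r} → x ≡ fromℕ< t<r → toℕ x ≡ t
fromℕ<-value t<r refl = FinP.toℕ-fromℕ< t<r

prefix-step : ∀ {r t} (t<r : t < r) (x : Fin r) →
              ⟦ toℕ x <? suc t ⟧ ≡ ⟦ toℕ x <? t ⟧ + ⟦ x Fin.≟ fromℕ< t<r ⟧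
prefix-step {t = t} t<r x with ℕP.<-cmp (toℕ x) t
... | tri< x<t x≢t _ =
  trans (⟦⟧-yes (toℕ x <? suc t) (ℕP.m<n⇒m<1+n x<t))
        (cong₂ _+_ (sym (⟦⟧-yes (toℕ x <? t) x<t)) (sym (⟦⟧-no (x Fin.≟ _) (x≢t ∘ fromℕ<-value t<r))))
... | tri≈ x≮t x≡t _ =
  trans (⟦⟧-yes (toℕ x <? suc t) (s≤s (ℕP.≤-reflexive x≡t)))
        (cong₂ _+_ (sym (⟦⟧-no (toℕ x <? t) x≮t))
                   (sym (⟦⟧-yes (x Fin.≟ _) (FinP.toℕ-injective (trans x≡t (sym (FinP.toℕ-fromℕ< t<r)))))))
... | tri> _ x≢t t<x =
  trans (⟦⟧-no (toℕ x <? suc t) (ℕP.<⇒≱ t<x ∘ ℕP.≤-pred))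
        (cong₂ _+_ (sym (⟦⟧-no (toℕ x <? t) (ℕP.<⇒≯ t<x)))
                   (sym (⟦⟧-no (x Fin.≟ _) (x≢t ∘ fromℕ<-value t<r))))

sum-mono : ∀ {m} {f g : Fin m → ℕ} → (∀ i → f i ≤ g i) → sum f ≤ sum g
sum-mono {zero}  f≤g = z≤n
sum-mono {suc m} f≤g = ℕP.+-mono-≤ (f≤g zero) (sum-mono (f≤g ∘ suc))

sum-mono-< : ∀ {m} {f g : Fin m → ℕ} → (∀ i → f i ≤ g i) → ∀ w → f w < g w → sum f < sum g
sum-mono-< f≤g zero    fw<gw = ℕP.+-mono-<-≤ fw<gw (sum-mono (f≤g ∘ suc))
sum-mono-< f≤g (suc w) fw<gw = ℕP.+-mono-≤-< (f≤g zero) (sum-mono-< (f≤g ∘ suc) w fw<gw)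

sum-ones : ∀ m → ∑[ i < m ] 1 ≡ m
sum-ones zero    = refl
sum-ones (suc m) = cong suc (sum-ones m)

sum-pick : ∀ {m} (w : Fin m) (f : Fin m → ℕ) → ∑[ i < m ] (⟦ i Fin.≟ w ⟧ * f i) ≡ f w
sum-pick {suc m} zero    f = trans (cong₂ _+_ (ℕP.+-identityʳ (f zero)) (sum-replicate-zero m))
                                   (ℕP.+-identityʳ (f zero))
sum-pick         (suc w) f = sum-pick w (f ∘ suc)

∣tabulate∣ : ∀ {m} {p} {P : Fin m → Set p} (P? : ∀ v → Dec (P v)) →
             ∣ tabulate (λ v → isYes (P? v)) ∣ ≡ ∑[ v < m ] ⟦ P? v ⟧
∣tabulate∣ {zero}  P? = refl
∣tabulate∣ {suc m} P? with P? zero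
... | yes _ = cong suc (∣tabulate∣ (P? ∘ suc))
... | no _  = ∣tabulate∣ (P? ∘ suc)

total : ∀ {A : Set} → (A → ℕ) → List A → ℕ
total g xs = ListSum.sum (List.map g xs)

module _ {A : Set} where

  length-filter : ∀ {p} {P : A → Set p} (P? : ∀ x → Dec (P x)) xs →
                  length (filter P? xs) ≡ total (λ x → ⟦ P? x ⟧) xs
  length-filter P? []       = refl
  length-filter P? (x ∷ xs) with P? x
  ... | yes _ = cong suc (length-filter P? xs)
  ... | no _  = length-filter P? xs

  total-filter : ∀ {p} {P : A → Set p} (P? : ∀ x → Dec (P x)) (g : A → ℕ) xs →
                 total g (filter P? xs) ≡ total (λ x → ⟦ P? x ⟧ * g x) xs
  total-filter P? g []       = refl
  total-filter P? g (x ∷ xs) with P? x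
  ... | yes _ = cong₂ _+_ (sym (ℕP.+-identityʳ (g x))) (total-filter P? g xs)
  ... | no _  = total-filter P? g xs

  total-tabulate : ∀ {m} (f : Fin m → A) (g : A → ℕ) → total g (List.tabulate f) ≡ ∑[ i < m ] g (f i)
  total-tabulate {zero}  f g = refl
  total-tabulate {suc m} f g = cong (g (f zero) +_) (total-tabulate (f ∘ suc) g)

  total-map : ∀ {B : Set} (f : A → B) (g : B → ℕ) xs → total g (List.map f xs) ≡ total (g ∘ f) xs
  total-map f g xs = cong ListSum.sum (sym (ListP.map-∘ xs))

  total-concatMap : ∀ {B : Set} (f : A → List B) (g : B → ℕ) xs →
                    total g (concatMap f xs) ≡ total (λ x → total g (f x)) xs
  total-concatMap f g []       = refl
  total-concatMap f g (x ∷ xs) = begin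
    ListSum.sum (List.map g (f x List.++ concatMap f xs))
      ≡⟨ cong ListSum.sum (ListP.map-++ g (f x) (concatMap f xs)) ⟩
    ListSum.sum (List.map g (f x) List.++ List.map g (concatMap f xs))
      ≡⟨ ListSumP.sum-++ (List.map g (f x)) _ ⟩
    total g (f x) + total g (concatMap f xs)
      ≡⟨ cong (total g (f x) +_) (total-concatMap f g xs) ⟩
    total g (f x) + total (λ y → total g (f y)) xs ∎
    where open ≡-Reasoning

∈-block⁻ : ∀ {n r} (f : Fin n → Fin r) {i v} → v ∈ block f i → f v ≡ i
∈-block⁻ f {i} {v} v∈ with f v Fin.≟ i | trans (sym (lookup∘tabulate _ v)) ([]=⇒lookup v∈)
... | yes fv≡i | _ = fv≡i
... | no _     | ()

∈-block⁺ : ∀ {n r} (f : Fin n → Fin r) {i v} → f v ≡ i → v ∈ block f i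
∈-block⁺ f {i} {v} fv≡i = lookup⇒[]= v (block f i) (trans (lookup∘tabulate _ v) (decided (f v Fin.≟ i)))
  where
  decided : (d : Dec (f v ≡ i)) → isYes d ≡ true
  decided (yes _)   = refl
  decided (no fv≢i) = ⊥-elim (fv≢i fv≡i)

subset-of-size : ∀ {m} (K : Subset m) k → k ≤ ∣ K ∣ → Σ (Subset m) λ K′ → K′ ⊆ K × ∣ K′ ∣ ≡ k
subset-of-size []         zero    _ = [] , (λ ()) , refl
subset-of-size (true ∷ K) (suc k) (s≤s k≤∣K∣) with subset-of-size K k k≤∣K∣
... | K′ , K′⊆K , ∣K′∣≡k = true ∷ K′ , (λ { here → here ; (there x∈) → there (K′⊆K x∈) }) , cong suc ∣K′∣≡k
subset-of-size (true ∷ K) zero    _ with subset-of-size K zero z≤n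
... | K′ , K′⊆K , ∣K′∣≡k = false ∷ K′ , (λ { (there x∈) → there (K′⊆K x∈) }) , ∣K′∣≡k
subset-of-size (false ∷ K) k      k≤∣K∣ with subset-of-size K k k≤∣K∣
... | K′ , K′⊆K , ∣K′∣≡k = false ∷ K′ , (λ { (there x∈) → there (K′⊆K x∈) }) , ∣K′∣≡k

clique-of-size : ∀ {n} {G : Graph n} {K : Subset n} k → IsClique G K → k ≤ ∣ K ∣ →
                 Σ (Subset n) λ K′ → K′ ⊆ K × IsClique G K′ × ∣ K′ ∣ ≡ k
clique-of-size k K-clique k≤∣K∣ with subset-of-size _ k k≤∣K∣
... | K′ , K′⊆K , ∣K′∣≡k =
  K′ , K′⊆K , (λ u v u∈ v∈ → K-clique u v (K′⊆K u∈) (K′⊆K v∈)) , ∣K′∣≡k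

-- Edges of a graph counted through a bilinear form on vertex weights.
module EdgeForm {n : ℕ} (G : Graph n) where

  A : Fin n → Fin n → ℕ
  A u v = ⟦ adj G u v Bool.≟ true ⟧

  A-sym : ∀ u v → A u v ≡ A v u
  A-sym u v = cong (λ b → ⟦ b Bool.≟ true ⟧) (Graph.sym G u v)

  A-false : ∀ {u v} → adj G u v ≡ false → A u v ≡ 0
  A-false nonadjacent = cong (λ b → ⟦ b Bool.≟ true ⟧) nonadjacent

  deg : (Fin n → ℕ) → Fin n → ℕ
  deg y u = ∑[ v < n ] (y v * A u v)

  E : (Fin n → ℕ) → (Fin n → ℕ) → ℕ
  E x y = ∑[ u < n ] (x u * deg y u)

  E-sym : ∀ x y → E x y ≡ E y x
  E-sym x y = begin
    ∑[ u < n ] (x u * ∑[ v < n ] (y v * A u v))  ≡⟨ sum-cong-≗ (λ u → *-distribˡ-sum (x u) (λ v → y v * A u v)) ⟩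
    ∑[ u < n ] ∑[ v < n ] (x u * (y v * A u v))  ≡⟨ ∑-comm (λ u v → x u * (y v * A u v)) ⟩
    ∑[ v < n ] ∑[ u < n ] (x u * (y v * A u v))  ≡⟨ sum-cong-≗ (λ v → sum-cong-≗ (λ u → exchange u v)) ⟩
    ∑[ v < n ] ∑[ u < n ] (y v * (x u * A v u))  ≡⟨ sum-cong-≗ (λ v → *-distribˡ-sum (y v) (λ u → x u * A v u)) ⟨
    ∑[ v < n ] (y v * ∑[ u < n ] (x u * A v u))  ∎
    where
    open ≡-Reasoning
    exchange : ∀ u v → x u * (y v * A u v) ≡ y v * (x u * A v u)
    exchange u v rewrite A-sym u v = x∙yz≈y∙xz (x u) (y v) (A v u)

  E-cong : ∀ {x x′ y y′} → (∀ u → x u ≡ x′ u) → (∀ u → y u ≡ y′ u) → E x y ≡ E x′ y′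
  E-cong x≗x′ y≗y′ = sum-cong-≗ (λ u → cong₂ _*_ (x≗x′ u) (sum-cong-≗ (λ v → cong (_* _) (y≗y′ v))))

  E-+ˡ : ∀ x y z → E (λ u → x u + y u) z ≡ E x z + E y z
  E-+ˡ x y z = trans (sum-cong-≗ (λ u → ℕP.*-distribʳ-+ (deg z u) (x u) (y u)))
                      (∑-distrib-+ (λ u → x u * deg z u) (λ u → y u * deg z u))

  E-+ʳ : ∀ x y z → E x (λ u → y u + z u) ≡ E x y + E x z
  E-+ʳ x y z = trans (E-sym x (λ u → y u + z u)) (trans (E-+ˡ y z x) (cong₂ _+_ (E-sym y x) (E-sym z x)))

  E-≤ : ∀ x y k → (∀ u → 0 < x u → deg y u ≤ k) → E x y ≤ k * sum x
  E-≤ x y k bounded = begin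
    ∑[ u < n ] (x u * deg y u)  ≤⟨ sum-mono weighted ⟩
    ∑[ u < n ] (x u * k)        ≡⟨ sum-cong-≗ (λ u → ℕP.*-comm (x u) k) ⟩
    ∑[ u < n ] (k * x u)        ≡⟨ *-distribˡ-sum k x ⟨
    k * sum x                   ∎
    where
    open ℕP.≤-Reasoning
    weighted : ∀ u → x u * deg y u ≤ x u * k
    weighted u with x u | bounded u
    ... | zero  | _     = z≤n
    ... | suc m | deg≤k = ℕP.*-monoʳ-≤ (suc m) (deg≤k (s≤s z≤n))

  edgeCount-∑ : edgeCount G ≡ ∑[ u < n ] ∑[ v < n ] (⟦ u Fin.<? v ⟧ * A u v)
  edgeCount-∑ = begin
    length (filter Adj? (filter Lt? pairs))          ≡⟨ length-filter Adj? (filter Lt? pairs) ⟩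
    total (λ q → ⟦ Adj? q ⟧) (filter Lt? pairs)      ≡⟨ total-filter Lt? _ pairs ⟩
    total weight pairs                               ≡⟨ total-concatMap row weight (allFin n) ⟩
    total (λ u → total weight (row u)) (allFin n)    ≡⟨ total-tabulate (λ u → u) (λ u → total weight (row u)) ⟩
    ∑[ u < n ] total weight (row u)                  ≡⟨ sum-cong-≗ (λ u → total-map (u ,_) weight (allFin n)) ⟩
    ∑[ u < n ] total (weight ∘ (u ,_)) (allFin n)    ≡⟨ sum-cong-≗ (λ u → total-tabulate (λ v → v) (weight ∘ (u ,_))) ⟩
    ∑[ u < n ] ∑[ v < n ] (⟦ u Fin.<? v ⟧ * A u v)  ∎
    where
    open ≡-Reasoning
    Lt? : (q : Fin n × Fin n) → Dec (proj₁ q Fin.< proj₂ q)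
    Lt? q = proj₁ q Fin.<? proj₂ q
    Adj? : (q : Fin n × Fin n) → Dec (adj G (proj₁ q) (proj₂ q) ≡ true)
    Adj? q = adj G (proj₁ q) (proj₂ q) Bool.≟ true
    weight : Fin n × Fin n → ℕ
    weight q = ⟦ Lt? q ⟧ * ⟦ Adj? q ⟧
    row : Fin n → List (Fin n × Fin n)
    row u = List.map (u ,_) (allFin n)
    pairs : List (Fin n × Fin n)
    pairs = concatMap row (allFin n)

  A-split : ∀ u v → A u v ≡ ⟦ u Fin.<? v ⟧ * A u v + ⟦ v Fin.<? u ⟧ * A u v
  A-split u v with FinP.<-cmp u v
  ... | tri< u<v _ v≮u rewrite ⟦⟧-yes (u Fin.<? v) u<v | ⟦⟧-no (v Fin.<? u) v≮u =
    sym (trans (ℕP.+-identityʳ _) (ℕP.*-identityˡ _))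
  ... | tri> u≮v _ v<u rewrite ⟦⟧-no (u Fin.<? v) u≮v | ⟦⟧-yes (v Fin.<? u) v<u =
    sym (ℕP.*-identityˡ _)
  ... | tri≈ u≮u refl _ rewrite ⟦⟧-no (u Fin.<? u) u≮u | A-false (irrefl G u) = refl

  E-all : E (λ _ → 1) (λ _ → 1) ≡ 2 * edgeCount G
  E-all = begin
    E (λ _ → 1) (λ _ → 1)
      ≡⟨ sum-cong-≗ (λ u → trans (ℕP.*-identityˡ _) (sum-cong-≗ (λ v → ℕP.*-identityˡ (A u v)))) ⟩
    ∑[ u < n ] ∑[ v < n ] A u v
      ≡⟨ sum-cong-≗ (λ u → trans (sum-cong-≗ (A-split u)) (∑-distrib-+ (before u) (after u))) ⟩
    ∑[ u < n ] (∑[ v < n ] (⟦ u Fin.<? v ⟧ * A u v) + ∑[ v < n ] (⟦ v Fin.<? u ⟧ * A u v))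
      ≡⟨ ∑-distrib-+ (λ u → sum (before u)) (λ u → sum (after u)) ⟩
    e + ∑[ u < n ] ∑[ v < n ] (⟦ v Fin.<? u ⟧ * A u v)
      ≡⟨ cong (e +_) (∑-comm after) ⟩
    e + ∑[ v < n ] ∑[ u < n ] (⟦ v Fin.<? u ⟧ * A u v)
      ≡⟨ cong (e +_) (sum-cong-≗ (λ v → sum-cong-≗ (λ u → cong (⟦ v Fin.<? u ⟧ *_) (A-sym u v)))) ⟩
    e + e
      ≡⟨ cong (e +_) (ℕP.+-identityʳ e) ⟨
    2 * e
      ≡⟨ cong (2 *_) edgeCount-∑ ⟨
    2 * edgeCount G ∎
    where
    open ≡-Reasoning
    before after : Fin n → Fin n → ℕ
    before u v = ⟦ u Fin.<? v ⟧ * A u v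
    after  u v = ⟦ v Fin.<? u ⟧ * A u v
    e : ℕ
    e = ∑[ u < n ] ∑[ v < n ] before u v

-- The bound after t blocks of which R have at least two and c exactly
-- three vertices.
bound : ℕ → ℕ → ℕ → ℕ
bound t R c = t * (R + c) + R * c

size-split : ∀ s → 1 ≤ s → s ≤ 3 → s ≡ 1 + ⟦ 2 ≤? s ⟧ + ⟦ 3 ≤? s ⟧
size-split 1 _ _ = refl
size-split 2 _ _ = refl
size-split 3 _ _ = refl
size-split (suc (suc (suc (suc _)))) _ (s≤s (s≤s (s≤s ())))

-- The inductive step in numbers: when a block of size s is added to t
-- blocks with N = t + R + c vertices, the doubled edge count grows by at
-- most 2 (s - 1) N + (s - 1) s, and the doubled bound grows by at least that.
bound-step : ∀ t R c s → 1 ≤ s → s ≤ 3 →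
             2 * bound t R c + 2 * (pred s * (t + R + c)) + pred s * s
               ≤ 2 * bound (suc t) (R + ⟦ 2 ≤? s ⟧) (c + ⟦ 3 ≤? s ⟧)
bound-step t R c 1 _ _ = ℕP.≤-trans (ℕP.m≤m+n _ (2 * (R + c))) (ℕP.≤-reflexive (grow₁ t R c))
  where
  grow₁ : ∀ t R c → 2 * (t * (R + c) + R * c) + 2 * (0 * (t + R + c)) + 0 * 1 + 2 * (R + c)
                    ≡ 2 * (suc t * ((R + 0) + (c + 0)) + (R + 0) * (c + 0))
  grow₁ = solve-∀
bound-step t R c 2 _ _ = ℕP.≤-trans (ℕP.m≤m+n _ (2 * c)) (ℕP.≤-reflexive (grow₂ t R c))
  where
  grow₂ : ∀ t R c → 2 * (t * (R + c) + R * c) + 2 * (1 * (t + R + c)) + 1 * 2 + 2 * c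
                    ≡ 2 * (suc t * ((R + 1) + (c + 0)) + (R + 1) * (c + 0))
  grow₂ = solve-∀
bound-step t R c 3 _ _ = ℕP.≤-reflexive (grow₃ t R c)
  where
  grow₃ : ∀ t R c → 2 * (t * (R + c) + R * c) + 2 * (2 * (t + R + c)) + 2 * 3
                    ≡ 2 * (suc t * ((R + 1) + (c + 1)) + (R + 1) * (c + 1))
  grow₃ = solve-∀
bound-step t R c (suc (suc (suc (suc _)))) _ (s≤s (s≤s (s≤s ())))

-- The right-hand side of the theorem is the bound once n = r + R + c.
bound-ℤ : ∀ r R c → ℤ.+ r ℤ.* (ℤ.+ (r + R + c) ℤ.- ℤ.+ r) ℤ.+ ℤ.+ R ℤ.* (ℤ.+ (r + R + c) ℤ.- ℤ.+ r ℤ.- ℤ.+ R)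
                      ≡ ℤ.+ bound r R c
bound-ℤ r R c = begin
  ℤ.+ r ℤ.* (ℤ.+ (r + R + c) ℤ.- ℤ.+ r) ℤ.+ ℤ.+ R ℤ.* (ℤ.+ (r + R + c) ℤ.- ℤ.+ r ℤ.- ℤ.+ R)
    ≡⟨ cong (λ m → ℤ.+ r ℤ.* (m ℤ.- ℤ.+ r) ℤ.+ ℤ.+ R ℤ.* (m ℤ.- ℤ.+ r ℤ.- ℤ.+ R)) (pos-+₃ r R c) ⟩
  ℤ.+ r ℤ.* ((ℤ.+ r ℤ.+ ℤ.+ R ℤ.+ ℤ.+ c) ℤ.- ℤ.+ r) ℤ.+ ℤ.+ R ℤ.* ((ℤ.+ r ℤ.+ ℤ.+ R ℤ.+ ℤ.+ c) ℤ.- ℤ.+ r ℤ.- ℤ.+ R)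
    ≡⟨ cancel (ℤ.+ r) (ℤ.+ R) (ℤ.+ c) ⟩
  ℤ.+ r ℤ.* (ℤ.+ R ℤ.+ ℤ.+ c) ℤ.+ ℤ.+ R ℤ.* ℤ.+ c
    ≡⟨ cong₂ ℤ._+_ (cong (ℤ.+ r ℤ.*_) (ℤP.pos-+ R c)) refl ⟨
  ℤ.+ r ℤ.* ℤ.+ (R + c) ℤ.+ ℤ.+ R ℤ.* ℤ.+ c
    ≡⟨ cong₂ ℤ._+_ (ℤP.pos-* r (R + c)) (ℤP.pos-* R c) ⟨
  ℤ.+ (r * (R + c)) ℤ.+ ℤ.+ (R * c)
    ≡⟨ ℤP.pos-+ (r * (R + c)) (R * c) ⟨
  ℤ.+ bound r R c ∎
  where
  open ≡-Reasoning
  pos-+₃ : ∀ a b d → ℤ.+ (a + b + d) ≡ ℤ.+ a ℤ.+ ℤ.+ b ℤ.+ ℤ.+ d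
  pos-+₃ a b d = trans (ℤP.pos-+ (a + b) d) (cong (ℤ._+ ℤ.+ d) (ℤP.pos-+ a b))
  cancel : ∀ (x y z : ℤ.ℤ) → x ℤ.* ((x ℤ.+ y ℤ.+ z) ℤ.- x) ℤ.+ y ℤ.* ((x ℤ.+ y ℤ.+ z) ℤ.- x ℤ.- y)
                         ≡ x ℤ.* (y ℤ.+ z) ℤ.+ y ℤ.* z
  cancel = ℤSolver.solve-∀

module GreedyPartition {n : ℕ} {G : Graph n} (k4-free : K4Free G) {r : ℕ}
                       (P : GoodPartition G r) (greedy : IsGreedy P) where
  open EdgeForm G

  p : Fin n → Fin r
  p = part P

  s : Fin r → ℕ
  s = size P

  B : Fin r → Fin n → ℕ
  B j u = ⟦ p u Fin.≟ j ⟧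

  size-∑ : ∀ j → s j ≡ sum (B j)
  size-∑ j = ∣tabulate∣ (λ v → p v Fin.≟ j)

  size-pos : ∀ j → 1 ≤ s j
  size-pos j with nonempty P j
  ... | v , pv≡j = subst (_≤ s j) (∣⁅x⁆∣≡1 v)
    (p⊆q⇒∣p∣≤∣q∣ (λ w∈ → subst (_∈ block p j) (sym (x∈⁅y⁆⇒x≡y v w∈)) (∈-block⁺ p pv≡j)))

  size-≤3 : ∀ j → s j ≤ 3
  size-≤3 j with s j ≤? 3
  ... | yes s≤3 = s≤3
  ... | no  s≰3 with clique-of-size {G = G} 4 (clique P j) (ℕP.≰⇒> s≰3)
  ...   | K , _ , K-clique , ∣K∣≡4 = ⊥-elim (k4-free (K , K-clique , ∣K∣≡4))

  deg-< : ∀ {u v j} → p v ≡ j → adj G u v ≡ false → deg (B j) u < s j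
  deg-< {u} {v} {j} pv≡j nonadjacent =
    subst (deg (B j) u <_) (sym (size-∑ j)) (sum-mono-< B·A≤B v strict)
    where
    B·A≤B : ∀ w → B j w * A u w ≤ B j w
    B·A≤B w = ℕP.≤-trans (ℕP.*-monoʳ-≤ (B j w) (⟦⟧≤1 (adj G u w Bool.≟ true)))
                         (ℕP.≤-reflexive (ℕP.*-identityʳ (B j w)))
    strict : B j v * A u v < B j v
    strict rewrite ⟦⟧-yes (p v Fin.≟ j) pv≡j | A-false nonadjacent = s≤s z≤n

  -- Greediness: no vertex u of an earlier block is adjacent to all of block
  -- j, for then Cⱼ ∪ {u} would contain a clique on s j + 1 vertices inside
  -- C₀ ∪ … ∪ Cⱼ.
  not-dominated : ∀ {u j} → toℕ (p u) < toℕ j → ¬ (∀ v → p v ≡ j → adj G u v ≡ true)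
  not-dominated {u} {j} pu<j u-adjacent = refute (clique-of-size {G = G} (suc (s j)) K-clique s<∣K∣)
    where
    K : Subset n
    K = block p j ∪ ⁅ u ⁆

    member : ∀ {v} → v ∈ K → p v ≡ j ⊎ v ≡ u
    member v∈ = Sum.map (∈-block⁻ p) (x∈⁅y⁆⇒x≡y u) (x∈p∪q⁻ (block p j) ⁅ u ⁆ v∈)

    K-prefix : ∀ {v} → v ∈ K → p v Fin.≤ j
    K-prefix v∈ with member v∈
    ... | inj₁ pv≡j = ℕP.≤-reflexive (cong toℕ pv≡j)
    ... | inj₂ refl = ℕP.<⇒≤ pu<j

    K-clique : IsClique G K
    K-clique a b a∈ b∈ a≢b with member a∈ | member b∈
    ... | inj₁ pa≡j | inj₁ pb≡j = clique P j a b (∈-block⁺ p pa≡j) (∈-block⁺ p pb≡j) a≢b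
    ... | inj₂ refl | inj₁ pb≡j = u-adjacent b pb≡j
    ... | inj₁ pa≡j | inj₂ refl = trans (Graph.sym G a u) (u-adjacent a pa≡j)
    ... | inj₂ refl | inj₂ refl = ⊥-elim (a≢b refl)

    s<∣K∣ : s j < ∣ K ∣
    s<∣K∣ = p⊂q⇒∣p∣<∣q∣ (p⊆p∪q ⁅ u ⁆ , u , x∈p∪q⁺ (inj₂ (x∈⁅x⁆ u)) ,
                         λ u∈ → ℕP.<-irrefl (cong toℕ (∈-block⁻ p u∈)) pu<j)

    refute : (Σ (Subset n) λ K′ → K′ ⊆ K × IsClique G K′ × ∣ K′ ∣ ≡ suc (s j)) → ⊥
    refute (K′ , K′⊆K , K′-clique , ∣K′∣≡) =
      greedy j (ℕP.≤-trans (s≤s z≤n) pu<j) (K′ , (λ v v∈ → K-prefix (K′⊆K v∈)) , K′-clique , ∣K′∣≡)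

  deg-block : ∀ {u j} → toℕ (p u) ≤ toℕ j → deg (B j) u < s j
  deg-block {u} {j} pu≤j with ℕP.m≤n⇒m<n∨m≡n pu≤j
  ... | inj₂ pu≡j = deg-< (FinP.toℕ-injective pu≡j) (irrefl G u)
  ... | inj₁ pu<j with FinP.any? (λ v → (p v Fin.≟ j) ×-dec (adj G u v Bool.≟ false))
  ...   | yes (v , pv≡j , nonadjacent) = deg-< pv≡j nonadjacent
  ...   | no none = ⊥-elim (not-dominated pu<j
                      (λ v pv≡j → BoolP.¬-not (λ nonadjacent → none (v , pv≡j , nonadjacent))))

  E-into-block : ∀ x j → (∀ u → 0 < x u → toℕ (p u) ≤ toℕ j) → E x (B j) ≤ pred (s j) * sum x
  E-into-block x j supported =
    E-≤ x (B j) (pred (s j)) (λ u xu>0 → ℕP.<⇒≤pred (deg-block (supported u xu>0)))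

  I : ℕ → Fin n → ℕ
  I t u = ⟦ toℕ (p u) <? t ⟧

  blocks≥ : ℕ → ℕ → ℕ
  blocks≥ k t = ∑[ j < r ] (⟦ toℕ j <? t ⟧ * ⟦ k ≤? s j ⟧)

  module Step {t : ℕ} (t<r : t < r) where
    next : Fin r
    next = fromℕ< t<r

    I-step : ∀ u → I (suc t) u ≡ I t u + B next u
    I-step u = prefix-step t<r (p u)

    vertices-step : sum (I (suc t)) ≡ sum (I t) + s next
    vertices-step = trans (sum-cong-≗ I-step)
                          (trans (∑-distrib-+ (I t) (B next)) (cong (sum (I t) +_) (sym (size-∑ next))))

    blocks≥-step : ∀ k → blocks≥ k (suc t) ≡ blocks≥ k t + ⟦ k ≤? s next ⟧
    blocks≥-step k = begin
      ∑[ j < r ] (⟦ toℕ j <? suc t ⟧ * big j)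
        ≡⟨ sum-cong-≗ (λ j → trans (cong (_* big j) (prefix-step t<r j))
                                    (ℕP.*-distribʳ-+ (big j) ⟦ toℕ j <? t ⟧ ⟦ j Fin.≟ next ⟧)) ⟩
      ∑[ j < r ] (⟦ toℕ j <? t ⟧ * big j + ⟦ j Fin.≟ next ⟧ * big j)
        ≡⟨ ∑-distrib-+ (λ j → ⟦ toℕ j <? t ⟧ * big j) (λ j → ⟦ j Fin.≟ next ⟧ * big j) ⟩
      blocks≥ k t + ∑[ j < r ] (⟦ j Fin.≟ next ⟧ * big j)
        ≡⟨ cong (blocks≥ k t +_) (sum-pick next big) ⟩
      blocks≥ k t + big next ∎
      where
      open ≡-Reasoning
      big : Fin r → ℕ
      big j = ⟦ k ≤? s j ⟧

    -- The doubled edge count grows by 2 E(I, B) + E(B, B), where I is the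
    -- indicator of the first t blocks and B that of the new one; both terms
    -- are bounded by E-into-block.
    edges-step : E (I (suc t)) (I (suc t))
                   ≤ E (I t) (I t) + 2 * (pred (s next) * sum (I t)) + pred (s next) * s next
    edges-step = begin
      E (I (suc t)) (I (suc t))                  ≡⟨ E-cong I-step I-step ⟩
      E I+B I+B                                  ≡⟨ E-+ˡ Iₜ Bₙ I+B ⟩
      E Iₜ I+B + E Bₙ I+B                        ≡⟨ cong₂ _+_ (E-+ʳ Iₜ Iₜ Bₙ) (E-+ʳ Bₙ Iₜ Bₙ) ⟩
      (E Iₜ Iₜ + E Iₜ Bₙ) + (E Bₙ Iₜ + E Bₙ Bₙ)  ≡⟨ cong (λ m → (E Iₜ Iₜ + E Iₜ Bₙ) + (m + E Bₙ Bₙ)) (E-sym Bₙ Iₜ) ⟩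
      (E Iₜ Iₜ + E Iₜ Bₙ) + (E Iₜ Bₙ + E Bₙ Bₙ)  ≡⟨ regroup (E Iₜ Iₜ) (E Iₜ Bₙ) (E Bₙ Bₙ) ⟩
      E Iₜ Iₜ + 2 * E Iₜ Bₙ + E Bₙ Bₙ            ≤⟨ ℕP.+-mono-≤ (ℕP.+-monoʳ-≤ (E Iₜ Iₜ) (ℕP.*-monoʳ-≤ 2 earlier)) within ⟩
      E Iₜ Iₜ + 2 * (k * sum Iₜ) + k * sum Bₙ    ≡⟨ cong (λ m → E Iₜ Iₜ + 2 * (k * sum Iₜ) + k * m) (size-∑ next) ⟨
      E Iₜ Iₜ + 2 * (k * sum Iₜ) + k * s next    ∎
      where
      open ℕP.≤-Reasoning
      Iₜ Bₙ I+B : Fin n → ℕ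
      Iₜ = I t
      Bₙ = B next
      I+B u = Iₜ u + Bₙ u
      k : ℕ
      k = pred (s next)
      regroup : ∀ a b c → (a + b) + (b + c) ≡ a + 2 * b + c
      regroup = solve-∀
      earlier : E Iₜ Bₙ ≤ k * sum Iₜ
      earlier = E-into-block Iₜ next (λ u Iu>0 → ℕP.≤-trans (ℕP.<⇒≤ (⟦⟧-witness (toℕ (p u) <? t) Iu>0))
                                                         (ℕP.≤-reflexive (sym (FinP.toℕ-fromℕ< t<r))))
      within : E Bₙ Bₙ ≤ k * sum Bₙ
      within = E-into-block Bₙ next (λ u Bu>0 → ℕP.≤-reflexive (cong toℕ (⟦⟧-witness (p u Fin.≟ next) Bu>0)))

  Invariant : ℕ → Set
  Invariant t = sum (I t) ≡ t + blocks≥ 2 t + blocks≥ 3 t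
              × E (I t) (I t) ≤ 2 * bound t (blocks≥ 2 t) (blocks≥ 3 t)

  invariant : ∀ t → t ≤ r → Invariant t
  invariant zero    _   = trans (sum-replicate-zero n) (sym (cong₂ _+_ (sum-replicate-zero r) (sum-replicate-zero r)))
                        , subst (_≤ 2 * bound 0 (blocks≥ 2 0) (blocks≥ 3 0)) (sym (sum-replicate-zero n)) z≤n
  invariant (suc t) t<r with invariant t (ℕP.<⇒≤ t<r)
  ... | vertices , edges = vertices′ , edges′
    where
    open Step t<r
    S R c R′ c′ : ℕ
    S  = s next
    R  = blocks≥ 2 t
    c  = blocks≥ 3 t
    R′ = blocks≥ 2 (suc t)
    c′ = blocks≥ 3 (suc t)
    open ≡-Reasoning
    regroup : ∀ t R c a b → t + R + c + (1 + a + b) ≡ suc t + (R + a) + (c + b)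
    regroup = solve-∀
    vertices′ : sum (I (suc t)) ≡ suc t + R′ + c′
    vertices′ = begin
      sum (I (suc t))                                ≡⟨ vertices-step ⟩
      sum (I t) + S                                  ≡⟨ cong₂ _+_ vertices (size-split S (size-pos next) (size-≤3 next)) ⟩
      t + R + c + (1 + ⟦ 2 ≤? S ⟧ + ⟦ 3 ≤? S ⟧)      ≡⟨ regroup t R c ⟦ 2 ≤? S ⟧ ⟦ 3 ≤? S ⟧ ⟩
      suc t + (R + ⟦ 2 ≤? S ⟧) + (c + ⟦ 3 ≤? S ⟧)   ≡⟨ cong₂ (λ a b → suc t + a + b) (blocks≥-step 2) (blocks≥-step 3) ⟨
      suc t + R′ + c′                                ∎
    edges′ : E (I (suc t)) (I (suc t)) ≤ 2 * bound (suc t) R′ c′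
    edges′ = ℕP.≤-trans edges-step (ℕP.≤-trans
      (ℕP.+-monoˡ-≤ (pred S * S) (ℕP.+-mono-≤ edges (ℕP.≤-reflexive (cong (λ m → 2 * (pred S * m)) vertices))))
      (subst₂ (λ a b → 2 * bound t R c + 2 * (pred S * (t + R + c)) + pred S * S ≤ 2 * bound (suc t) a b)
              (sym (blocks≥-step 2)) (sym (blocks≥-step 3))
              (bound-step t R c S (size-pos next) (size-≤3 next))))

  I-all : ∀ u → I r u ≡ 1
  I-all u = ⟦⟧-yes (toℕ (p u) <? r) (FinP.toℕ<n (p u))

  vertex-count : n ≡ r + blocks≥ 2 r + blocks≥ 3 r
  vertex-count = trans (sym (trans (sum-cong-≗ I-all) (sum-ones n))) (proj₁ (invariant r ℕP.≤-refl))

  edge-count : edgeCount G ≤ bound r (blocks≥ 2 r) (blocks≥ 3 r)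
  edge-count = ℕP.*-cancelˡ-≤ 2 (subst (_≤ 2 * bound r (blocks≥ 2 r) (blocks≥ 3 r))
                                       (trans (E-cong I-all I-all) E-all)
                                       (proj₂ (invariant r ℕP.≤-refl)))

  r₂-count : r₂ P ≡ blocks≥ 2 r
  r₂-count = begin
    r₂ P                                         ≡⟨ length-filter (λ j → 2 ≤? s j) (allFin r) ⟩
    total (λ j → ⟦ 2 ≤? s j ⟧) (allFin r)        ≡⟨ total-tabulate (λ j → j) (λ j → ⟦ 2 ≤? s j ⟧) ⟩
    ∑[ j < r ] ⟦ 2 ≤? s j ⟧                      ≡⟨ sum-cong-≗ all-early ⟨
    blocks≥ 2 r                                  ∎
    where
    open ≡-Reasoning
    all-early : ∀ j → ⟦ toℕ j <? r ⟧ * ⟦ 2 ≤? s j ⟧ ≡ ⟦ 2 ≤? s j ⟧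
    all-early j = trans (cong (_* ⟦ 2 ≤? s j ⟧) (⟦⟧-yes (toℕ j <? r) (FinP.toℕ<n j))) (ℕP.*-identityˡ _)

claim1 : ∀ (n : ℕ) (G : Graph n) → K4Free G →
         (r : ℕ) (P : GoodPartition G r) → IsGreedy P →
         ℤ.+ edgeCount G ℤ.≤ (ℤ.+ r) ℤ.* (ℤ.+ n ℤ.- ℤ.+ r) ℤ.+ (ℤ.+ r₂ P) ℤ.* (ℤ.+ n ℤ.- ℤ.+ r ℤ.- ℤ.+ r₂ P)
claim1 n G k4-free r P greedy =
  subst (ℤ.+ edgeCount G ℤ.≤_) rhs (ℤ.+≤+ edge-count)
  where
  open GreedyPartition k4-free P greedy
  R c : ℕ
  R = blocks≥ 2 r
  c = blocks≥ 3 r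
  rhs : ℤ.+ bound r R c ≡ ℤ.+ r ℤ.* (ℤ.+ n ℤ.- ℤ.+ r) ℤ.+ ℤ.+ r₂ P ℤ.* (ℤ.+ n ℤ.- ℤ.+ r ℤ.- ℤ.+ r₂ P)
  rhs = sym (trans (cong₂ (λ m q → ℤ.+ r ℤ.* (ℤ.+ m ℤ.- ℤ.+ r) ℤ.+ ℤ.+ q ℤ.* (ℤ.+ m ℤ.- ℤ.+ r ℤ.- ℤ.+ q))
                          vertex-count r₂-count)
                   (bound-ℤ r R c))
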